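{- Every $\tilde n$-diagram is equivalent, modulo isotopy and 2- and 3-moves, to an $\tilde n$-web. Equivalently, the map $\tilde\iota\colon\mathsf{W}\mathsf{C}_n\to\mathsf{D}\mathsf{C}_n$ induced by inclusion is surjective.
   Context: Let $\mathbb{S}^1$ be $[1,n+1]$ with $1$ and $n+1$ glued. An extended $\tilde n$-diagram is a continuous map from $n$ copies of $[0,1]$ to the cylinder $\mathbb{S}^1\times[0,1]$, each strand projecting vertically bijectively onto $[0,1]$, endpoints at $(k,0)$, $(l,1)$ with $k,l\in\{1,\dots,n\}$, injective except at finitely many interior transverse double points; considered up to isotopy, composed by stacking. The elementary $\tilde d_i$ ($1\le i\le n$) has all strands vertical except two strands from $(i,0)$ to $(i+1,1)$ and from $(i+1,0)$ to $(i,1)$ crossing once (position $n+1$ meaning $1$). $\tilde n$-diagrams are the elements of the monoid generated by $\tilde d_1,\dots,\tilde d_n$. 2-move: locally, two arcs crossing twice (bigon) $\leftrightarrow$ two arcs crossing once with the same boundary points. 3-move: locally, with lower points $B_1<B_2<B_3$ and upper points $T_1<T_2<T_3$, three pairwise crossing arcs $B_1T_3,B_2T_2,B_3T_1$ $\leftrightarrow$ arcs $B_1T_3,B_2T_1,B_3T_2$ with $B_1T_3$ crossing each of the other two once and these two not crossing. $\mathsf{D}\mathsf{C}_n$ is the monoid of $\tilde n$-diagrams modulo 2- and 3-moves. A bigon (two strands' arcs between two crossings) or triangle (three strands' arcs between pairwise crossings) is contractible if it bounds a contractible (disk) region of the cylinder. An $\tilde n$-web is an $\tilde n$-diagram without contractible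 bigons and contractible triangles; $\mathsf{W}\mathsf{C}_n$ is the set of $\tilde n$-webs up to isotopy. -}

module Defs where

open import Data.Nat as ℕ using (ℕ; zero; suc; _≤_; _≡ᵇ_)
open import Data.Nat.DivMod using (_%_)
open import Data.Integer as ℤ using (ℤ; +_)
open import Data.Integer.DivMod using (_%ℕ_)
open import Data.Fin using (Fin; toℕ)
open import Data.List using (List; []; _∷_; _++_; foldl)
open import Data.Bool using (if_then_else_)
open import Data.Product using (Σ; ∃; ∃-syntax; _×_; _,_)
open import Data.Sum using (_⊎_)
open import Relation.Binary.PropositionalEquality using (_≡_; _≢_)
open import Function using (_∘_; id)

-- Remainder mod n (n = 0 never occurs in the statement, where n ≥ 2).
modN : ℕ → ℕ → ℕ
modN x zero    = x
modN x (suc m) = x % suc m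

zmod : ℤ → ℕ → ℕ
zmod p zero    = 0
zmod p (suc m) = p %ℕ suc m

-- A generator i : Fin n stands for the paper's d̃_(i+1); it
-- crosses the strands at (0-based) cyclic positions i and i+1 (mod n),
-- position n being identified with position 0 (paper: n+1 ≡ 1).
-- A word is read BOTTOM TO TOP: the head of the list is the lowest
-- crossing (stacking = list concatenation, first list below).

Word : ℕ → Set
Word n = List (Fin n)

Next : (n : ℕ) → Fin n → Fin n → Set
Next n i j = modN (toℕ i ℕ.+ 1) n ≡ toℕ j

FarApart : (n : ℕ) → Fin n → Fin n → Set
FarApart n i j = (toℕ i ≢ toℕ j) × (¬Next i j) × (¬Next j i)
  where
  ¬Next : Fin n → Fin n → Set
  ¬Next a b = Next n a b → Data.Empty.⊥
    where import Data.Empty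

data Move (n : ℕ) : Word n → Word n → Set where
  isotopy : ∀ {i j} → FarApart n i j → Move n (i ∷ j ∷ []) (j ∷ i ∷ [])
  -- 2-move: bigon (two crossings of the same two arcs) ↔ single crossing
  move2   : ∀ {i} → Move n (i ∷ i ∷ []) (i ∷ [])
  -- 3-move: three pairwise crossing arcs B₁T₃, B₂T₂, B₃T₁ ↔ arcs
  -- B₁T₃, B₂T₁, B₃T₂ (bottom-to-top word  i , i+1).  Both reduced
  -- words of the pairwise-crossing configuration are covered.  A local
  -- disk with three distinct lower points requires n ≥ 3.
  move3a  : ∀ {i j} → 3 ≤ n → Next n i j →
            Move n (i ∷ j ∷ i ∷ []) (i ∷ j ∷ [])
  move3b  : ∀ {i j} → 3 ≤ n → Next n i j →
            Move n (j ∷ i ∷ j ∷ []) (i ∷ j ∷ [])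

-- Equivalence modulo isotopy and 2-/3-moves: the congruence (w.r.t.
-- stacking) equivalence relation generated by the moves.  Its quotient
-- is the monoid DC_n.
data Equiv (n : ℕ) : Word n → Word n → Set where
  ≈-refl  : ∀ {w} → Equiv n w w
  ≈-sym   : ∀ {w w′} → Equiv n w w′ → Equiv n w′ w
  ≈-trans : ∀ {w w′ w″} → Equiv n w w′ → Equiv n w′ w″ → Equiv n w w″
  ≈-move  : ∀ (u : Word n) {l r : Word n} (v : Word n) →
            Move n l r → Equiv n (u ++ l ++ v) (u ++ r ++ v)

-- Lifted strands in the universal cover ℝ × [0,1] of the cylinder.
-- The lift of strand position p ∈ ℤ (0-based) projects to cyclic
-- position p mod n.  `state w p` is the label (initial lifted position)
-- of the lifted strand sitting at position p after the word w.

τ : (n : ℕ) → Fin n → ℤ → ℤ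
τ n i p =
  if zmod p n ≡ᵇ toℕ i then p ℤ.+ ℤ.1ℤ
  else if zmod p n ≡ᵇ modN (toℕ i ℕ.+ 1) n then p ℤ.- ℤ.1ℤ
  else p

state : (n : ℕ) → Word n → ℤ → ℤ
state n = foldl (λ σ i → σ ∘ τ n i) id

-- The crossing given by the letter i placed right above the (lower)
-- part u of a word is a crossing of the lifted strands a and b.
CrossingOf : (n : ℕ) → Word n → Fin n → ℤ → ℤ → Set
CrossingOf n u i a b =
  ∃[ t ] ((state n u (+ toℕ i ℤ.+ t ℤ.* + n) ≡ a ×
           state n u (+ toℕ i ℤ.+ ℤ.1ℤ ℤ.+ t ℤ.* + n) ≡ b)
        ⊎ (state n u (+ toℕ i ℤ.+ t ℤ.* + n) ≡ b ×
           state n u (+ toℕ i ℤ.+ ℤ.1ℤ ℤ.+ t ℤ.* + n) ≡ a))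

-- Contractible bigon: two crossings of the same two strands whose arcs
-- between them bound a disk, i.e. the same two LIFTED strands cross twice.
HasContractibleBigon : (n : ℕ) → Word n → Set
HasContractibleBigon n w =
  ∃[ u ] ∃[ i ] ∃[ v ] ∃[ j ] ∃[ x ] (w ≡ u ++ i ∷ v ++ j ∷ x ×
    ∃[ a ] ∃[ b ] (CrossingOf n u i a b × CrossingOf n (u ++ i ∷ v) j a b))

-- Contractible triangle: three crossings, pairwise between three strands,
-- whose arcs bound a disk, i.e. between three fixed LIFTED strands.
HasContractibleTriangle : (n : ℕ) → Word n → Set
HasContractibleTriangle n w =
  ∃[ u ] ∃[ i ] ∃[ v ] ∃[ j ] ∃[ x ] ∃[ k ] ∃[ y ]
    (w ≡ u ++ i ∷ v ++ j ∷ x ++ k ∷ y ×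
     ∃[ a ] ∃[ b ] ∃[ c ]
       (CrossingOf n u i a b ×
        CrossingOf n (u ++ i ∷ v) j b c ×
        CrossingOf n (u ++ i ∷ v ++ j ∷ x) k a c))

IsWeb : (n : ℕ) → Word n → Set
IsWeb n w = (HasContractibleBigon n w → Data.Empty.⊥)
          × (HasContractibleTriangle n w → Data.Empty.⊥)
  where import Data.Empty

{-# OPTIONS --safe #-}
module Submission where

open import Defs
open import Data.Nat using (ℕ; _≤_)
open import Data.Product using (Σ; ∃; ∃-syntax; _×_)

open import Data.Bool using (true; false; if_then_else_; T)
open import Data.Empty using (⊥; ⊥-elim)
open import Data.Fin using (Fin; toℕ)
import Data.Fin.Properties as Finₚ
open import Data.Integer using (ℤ; +_; _+_; _-_; _*_; _<_; 1ℤ)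
import Data.Integer as ℤ
open import Data.Integer.DivMod using (_/ℕ_; n%ℕd<d; a≡a%ℕn+[a/ℕn]*n)
import Data.Integer.Properties as ℤₚ
open import Algebra.Properties.AbelianGroup ℤₚ.+-0-abelianGroup using (∙-cancelʳ)
open import Algebra.Properties.CommutativeSemigroup ℤₚ.+-commutativeSemigroup
  using () renaming (xy∙z≈xz∙y to +-right-comm)
open import Data.Integer.Tactic.RingSolver using (solve-∀)
open import Data.List using ([]; _∷_; _++_; [_]; _∷ʳ_; foldl; length)
import Data.List.Properties as Listₚ
open import Data.List.Reverse using (Reverse; reverseView; []; _∶_∶ʳ_)
open import Data.Nat using (suc; zero; s≤s; z≤n)
import Data.Nat as ℕ
open import Data.Nat.DivMod using (m<n⇒m%n≡m; n%n≡0)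
open import Data.Nat.Induction using (<-wellFounded)
import Data.Nat.Properties as ℕₚ
open import Data.Product using (_,_; proj₁; proj₂; uncurry)
import Data.Product as Product
open import Data.Sum using (_⊎_; inj₁; inj₂)
import Data.Sum as Sum
open import Function using (_∘_; id)
open import Induction.WellFounded using (Acc; acc)
open import Relation.Binary using (Setoid; tri<; tri≈; tri>)
import Relation.Binary.Reasoning.Setoid as SetoidReasoning
open import Relation.Binary.PropositionalEquality hiding ([_])
open import Relation.Nullary using (¬_; Dec; yes; no)
open import Relation.Nullary.Decidable using (_×-dec_; _⊎-dec_; map′)

-- Lift the strands to the universal cover ℝ × [0,1] of the cylinder, labelling each lifted strand
-- by its initial position in ℤ; after a word w the strand a sits at position π w a, and strands
-- a, b are inverted when π w reverses their order.  Without contractible bigons two lifted strands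
-- cross at most once, so the pairs crossed in w are exactly the inverted pairs, and three pairwise
-- inverted strands bound a contractible triangle.
--
-- A word is made into a web letter by letter.  Appending k to a web w closes a contractible bigon
-- or triangle only if the strands at the two positions exchanged by k are inverted, or are both
-- inverted with a third strand.  Then look at the last letter x of w = w₀ x.  If x = k, a 2-move
-- removes the new letter; if x is far from k, the two letters commute and we recurse into w₀; if
-- x is adjacent to k, either no disk is closed after all, or the inversions force w₀ to be
-- equivalent to a shorter word w₁ k, and a 3-move turns w₁ k x k into a word of length
-- |w₁| + 2 ≤ |w|.  So the new word is never longer than w, and induction on length ends with a web.

module Cylinder (m : ℕ) where

  n : ℕ
  n = suc (suc m)

  nℤ : ℤ
  nℤ = + n

  res : ℤ → ℕ
  res p = zmod p n

  next : ℕ → ℕ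
  next x = modN (x ℕ.+ 1) n

  infix 9 _⁺ _⁻

  _⁺ _⁻ : ℤ → ℤ
  p ⁺ = p + 1ℤ
  p ⁻ = p - 1ℤ

  ⁺⁻ : ∀ p → p ⁺ ⁻ ≡ p
  ⁺⁻ = ring where ring : ∀ p → p + 1ℤ - 1ℤ ≡ p ; ring = solve-∀

  ⁻⁺ : ∀ p → p ⁻ ⁺ ≡ p
  ⁻⁺ = ring where ring : ∀ p → p - 1ℤ + 1ℤ ≡ p ; ring = solve-∀

  p<p⁺ : ∀ p → p < p ⁺
  p<p⁺ p = ℤₚ.suc[i]≤j⇒i<j (ℤₚ.≤-reflexive (ℤₚ.+-comm 1ℤ p))

  p⁻<p : ∀ p → p ⁻ < p
  p⁻<p p = subst (p ⁻ <_) (⁻⁺ p) (p<p⁺ (p ⁻))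

  p⁻<p⁺ : ∀ p → p ⁻ < p ⁺
  p⁻<p⁺ p = ℤₚ.<-trans (p⁻<p p) (p<p⁺ p)

  p<p⁺⁺ : ∀ p → p < p ⁺ ⁺
  p<p⁺⁺ p = ℤₚ.<-trans (p<p⁺ p) (p<p⁺ (p ⁺))

  <⇒⁺≤ : ∀ {p q} → p < q → p ⁺ ℤ.≤ q
  <⇒⁺≤ {p} {q} p<q = subst (ℤ._≤ q) (ℤₚ.+-comm 1ℤ p) (ℤₚ.i<j⇒suc[i]≤j p<q)

  <⁺⇒≤ : ∀ {p q} → p < q ⁺ → p ℤ.≤ q
  <⁺⇒≤ {p} {q} p<q⁺ = subst₂ ℤ._≤_ (⁺⁻ p) (⁺⁻ q) (ℤₚ.+-monoˡ-≤ ℤ.-1ℤ (<⇒⁺≤ p<q⁺))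

  <-cycle : ∀ {a b c} → a < b → b < c → c < a → ⊥
  <-cycle a<b b<c c<a = ℤₚ.<-asym a<b (ℤₚ.<-trans b<c c<a)

  +-cancelʳ-< : ∀ {x y} s → x + s < y + s → x < y
  +-cancelʳ-< {x} {y} s lt = subst₂ _<_ (cancel x s) (cancel y s) (ℤₚ.+-monoˡ-< (ℤ.- s) lt)
    where
    cancel : ∀ x s → x + s + ℤ.- s ≡ x
    cancel = solve-∀

  -- Residues modulo n

  res<n : ∀ p → res p ℕ.< n
  res<n p = n%ℕd<d p n

  res-decomposition : ∀ p → p ≡ + res p + (p /ℕ n) * nℤ
  res-decomposition p = a≡a%ℕn+[a/ℕn]*n p n

  +*n-<-mono : ∀ {j} k {s t} → j ℕ.< n → s < t → + j + s * nℤ < + k + t * nℤ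
  +*n-<-mono {j} k {s} {t} j<n s<t = begin-strict
    + j + s * nℤ    <⟨ ℤₚ.+-monoˡ-< (s * nℤ) (ℤ.+<+ j<n) ⟩
    nℤ + s * nℤ     ≡⟨ factor s nℤ ⟩
    (1ℤ + s) * nℤ   ≤⟨ ℤₚ.*-monoʳ-≤-nonNeg nℤ (ℤₚ.i<j⇒suc[i]≤j s<t) ⟩
    t * nℤ          ≤⟨ ℤₚ.i≤j+i (t * nℤ) (+ k) ⟩
    + k + t * nℤ    ∎
    where
    open ℤₚ.≤-Reasoning
    factor : ∀ s n → n + s * n ≡ (1ℤ + s) * n
    factor = solve-∀

  decomposition-unique : ∀ {j k s t} → j ℕ.< n → k ℕ.< n → + j + s * nℤ ≡ + k + t * nℤ → j ≡ k
  decomposition-unique {j} {k} {s} {t} j<n k<n eq with ℤₚ.<-cmp s t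
  ... | tri< s<t _ _  = ⊥-elim (ℤₚ.<-irrefl eq (+*n-<-mono k j<n s<t))
  ... | tri> _ _ t<s  = ⊥-elim (ℤₚ.<-irrefl (sym eq) (+*n-<-mono j k<n t<s))
  ... | tri≈ _ refl _ = ℤₚ.+-injective (∙-cancelʳ (s * nℤ) (+ j) (+ k) eq)

  res-unique : ∀ {j} t → j ℕ.< n → res (+ j + t * nℤ) ≡ j
  res-unique {j} t j<n =
    sym (decomposition-unique {s = t} {t = p /ℕ n} j<n (res<n p) (res-decomposition p))
    where p = + j + t * nℤ

  res-+*n : ∀ p t → res (p + t * nℤ) ≡ res p
  res-+*n p t = begin
    res (p + t * nℤ)                        ≡⟨ cong (λ p′ → res (p′ + t * nℤ)) (res-decomposition p) ⟩
    res (+ res p + (p /ℕ n) * nℤ + t * nℤ)  ≡⟨ cong res (regroup (+ res p) (p /ℕ n) t nℤ) ⟩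
    res (+ res p + (p /ℕ n + t) * nℤ)       ≡⟨ res-unique (p /ℕ n + t) (res<n p) ⟩
    res p                                   ∎
    where
    open ≡-Reasoning
    regroup : ∀ a s t n → a + s * n + t * n ≡ a + (s + t) * n
    regroup = solve-∀

  res-⁺ : ∀ p → res (p ⁺) ≡ next (res p)
  res-⁺ p = begin
    res (p ⁺)                           ≡⟨ cong (λ p′ → res (p′ ⁺)) (res-decomposition p) ⟩
    res ((+ res p + (p /ℕ n) * nℤ) ⁺)   ≡⟨ cong res (+-right-comm (+ res p) (p /ℕ n * nℤ) 1ℤ) ⟩
    res ((+ res p) ⁺ + (p /ℕ n) * nℤ)   ≡⟨ res-+*n ((+ res p) ⁺) (p /ℕ n) ⟩
    next (res p)                        ∎
    where open ≡-Reasoning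

  res-+ : ∀ {j} → j ℕ.< n → res (+ j) ≡ j
  res-+ = m<n⇒m%n≡m

  next-res-⁻ : ∀ p → next (res (p ⁻)) ≡ res p
  next-res-⁻ p = trans (sym (res-⁺ (p ⁻))) (cong res (⁻⁺ p))

  next-cases : ∀ {x} → x ℕ.< n → (suc x ℕ.< n × next x ≡ suc x) ⊎ (suc x ≡ n × next x ≡ 0)
  next-cases {x} x<n with ℕₚ.m≤n⇒m<n∨m≡n x<n
  ... | inj₁ 1+x<n = inj₁ (1+x<n , trans (cong (ℕ._% n) (ℕₚ.+-comm x 1)) (m<n⇒m%n≡m 1+x<n))
  ... | inj₂ 1+x≡n = inj₂ (1+x≡n , trans (cong (ℕ._% n) (trans (ℕₚ.+-comm x 1) 1+x≡n)) (n%n≡0 n))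

  next-injective : ∀ {x y} → x ℕ.< n → y ℕ.< n → next x ≡ next y → x ≡ y
  next-injective x<n y<n eq with next-cases x<n | next-cases y<n
  ... | inj₁ (_ , ex) | inj₁ (_ , ey) = ℕₚ.suc-injective (trans (sym ex) (trans eq ey))
  ... | inj₂ (ex , _) | inj₂ (ey , _) = ℕₚ.suc-injective (trans ex (sym ey))
  ... | inj₁ (_ , ex) | inj₂ (_ , ey) with () ← trans (sym ex) (trans eq ey)
  ... | inj₂ (_ , ex) | inj₁ (_ , ey) with () ← trans (sym ey) (trans (sym eq) ex)

  next-≢ : ∀ {x} → x ℕ.< n → next x ≢ x
  next-≢ x<n eq with next-cases x<n
  ... | inj₁ (_ , ex)       = ℕₚ.1+n≢n (trans (sym ex) eq)
  ... | inj₂ (1+x≡n , ex) with () ← trans (cong suc (sym (trans (sym eq) ex))) 1+x≡n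

  n≢2 : 3 ≤ n → n ≢ 2
  n≢2 3≤n n≡2 = ℕₚ.<-irrefl refl (subst (3 ≤_) n≡2 3≤n)

  next²-≢ : ∀ {x} → 3 ≤ n → x ℕ.< n → next (next x) ≢ x
  next²-≢ {x} 3≤n x<n eq with next-cases x<n
  ... | inj₂ (1+x≡n , ex) = n≢2 3≤n (trans (sym 1+x≡n) (cong suc x≡1))
    where
    x≡1 : x ≡ 1
    x≡1 = trans (sym eq) (trans (cong next ex) (m<n⇒m%n≡m {n = n} (s≤s (s≤s z≤n))))
  ... | inj₁ (1+x<n , ex) with next-cases 1+x<n
  ...   | inj₁ (_ , ex′) = ℕₚ.<-irrefl (sym (trans (sym ex′) (trans (cong next (sym ex)) eq)))
                                        (ℕₚ.<-trans (ℕₚ.n<1+n x) (ℕₚ.n<1+n (suc x)))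
  ...   | inj₂ (2+x≡n , ex′) = n≢2 3≤n (trans (sym 2+x≡n) (cong (suc ∘ suc) x≡0))
    where
    x≡0 : x ≡ 0
    x≡0 = trans (sym eq) (trans (cong next ex) ex′)

  next-toℕ-≢ : ∀ (i : Fin n) → next (toℕ i) ≢ toℕ i
  next-toℕ-≢ i = next-≢ (Finₚ.toℕ<n i)

  -- The permutation τ n i of lifted positions

  Avoids : Fin n → ℤ → Set
  Avoids i p = res p ≢ toℕ i × res p ≢ next (toℕ i)

  data τ-View (i : Fin n) (p : ℤ) : Set where
    raises : res p ≡ toℕ i → τ n i p ≡ p ⁺ → τ-View i p
    lowers : res p ≡ next (toℕ i) → τ n i p ≡ p ⁻ → τ-View i p
    fixes  : Avoids i p → τ n i p ≡ p → τ-View i p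

  ≡ᵇ-true⇒≡ : ∀ {x y} → (x ℕ.≡ᵇ y) ≡ true → x ≡ y
  ≡ᵇ-true⇒≡ x≡ᵇy = ℕₚ.≡ᵇ⇒≡ _ _ (subst T (sym x≡ᵇy) _)

  ≡ᵇ-false⇒≢ : ∀ {x y} → (x ℕ.≡ᵇ y) ≡ false → x ≢ y
  ≡ᵇ-false⇒≢ x≢ᵇy x≡y = subst T x≢ᵇy (ℕₚ.≡⇒≡ᵇ _ _ x≡y)

  τ-unfold : ∀ i p {b₁ b₂} → (res p ℕ.≡ᵇ toℕ i) ≡ b₁ → (res p ℕ.≡ᵇ next (toℕ i)) ≡ b₂ →
             τ n i p ≡ (if b₁ then p ⁺ else (if b₂ then p ⁻ else p))
  τ-unfold i p refl refl = refl

  τ-view : ∀ i p → τ-View i p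
  τ-view i p with res p ℕ.≡ᵇ toℕ i in e₁ | res p ℕ.≡ᵇ next (toℕ i) in e₂
  ... | true  | _     = raises (≡ᵇ-true⇒≡ e₁) (τ-unfold i p e₁ e₂)
  ... | false | true  = lowers (≡ᵇ-true⇒≡ e₂) (τ-unfold i p e₁ e₂)
  ... | false | false = fixes (≡ᵇ-false⇒≢ e₁ , ≡ᵇ-false⇒≢ e₂) (τ-unfold i p e₁ e₂)

  τ-⁺ : ∀ i p → res p ≡ toℕ i → τ n i p ≡ p ⁺
  τ-⁺ i p r≡i with τ-view i p
  ... | raises _ eq       = eq
  ... | lowers r≡i⁺ _     = ⊥-elim (next-toℕ-≢ i (trans (sym r≡i⁺) r≡i))
  ... | fixes (r≢i , _) _ = ⊥-elim (r≢i r≡i)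

  τ-⁻ : ∀ i p → res p ≡ next (toℕ i) → τ n i p ≡ p ⁻
  τ-⁻ i p r≡i⁺ with τ-view i p
  ... | raises r≡i _       = ⊥-elim (next-toℕ-≢ i (trans (sym r≡i⁺) r≡i))
  ... | lowers _ eq        = eq
  ... | fixes (_ , r≢i⁺) _ = ⊥-elim (r≢i⁺ r≡i⁺)

  τ-avoids : ∀ i p → Avoids i p → τ n i p ≡ p
  τ-avoids i p (r≢i , r≢i⁺) with τ-view i p
  ... | raises r≡i _  = ⊥-elim (r≢i r≡i)
  ... | lowers r≡i⁺ _ = ⊥-elim (r≢i⁺ r≡i⁺)
  ... | fixes _ eq    = eq

  τ-swaps : ∀ i p → res p ≡ toℕ i → τ n i p ≡ p ⁺ × τ n i (p ⁺) ≡ p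
  τ-swaps i p r≡i = τ-⁺ i p r≡i , trans (τ-⁻ i (p ⁺) (trans (res-⁺ p) (cong next r≡i))) (⁺⁻ p)

  τ-involutive : ∀ i p → τ n i (τ n i p) ≡ p
  τ-involutive i p with τ-view i p
  ... | raises r≡i eq = trans (cong (τ n i) eq) (proj₂ (τ-swaps i p r≡i))
  ... | lowers r≡i⁺ eq = begin
    τ n i (τ n i p)  ≡⟨ cong (τ n i) eq ⟩
    τ n i (p ⁻)      ≡⟨ τ-⁺ i (p ⁻) r⁻≡i ⟩
    p ⁻ ⁺            ≡⟨ ⁻⁺ p ⟩
    p                ∎
    where
    open ≡-Reasoning
    r⁻≡i : res (p ⁻) ≡ toℕ i
    r⁻≡i = next-injective (res<n (p ⁻)) (Finₚ.toℕ<n i) (trans (next-res-⁻ p) r≡i⁺)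
  ... | fixes _ eq = trans (cong (τ n i) eq) eq

  τ-injective : ∀ i {p q} → τ n i p ≡ τ n i q → p ≡ q
  τ-injective i {p} {q} eq = trans (sym (τ-involutive i p)) (trans (cong (τ n i) eq) (τ-involutive i q))

  τ-periodic : ∀ i p t → τ n i (p + t * nℤ) ≡ τ n i p + t * nℤ
  τ-periodic i p t with τ-view i p
  ... | raises r≡i eq = begin
    τ n i (p + t * nℤ)   ≡⟨ τ-⁺ i (p + t * nℤ) (trans (res-+*n p t) r≡i) ⟩
    p + t * nℤ + 1ℤ      ≡⟨ +-right-comm p (t * nℤ) 1ℤ ⟩
    p ⁺ + t * nℤ         ≡⟨ cong (_+ t * nℤ) eq ⟨
    τ n i p + t * nℤ     ∎
    where open ≡-Reasoning
  ... | lowers r≡i⁺ eq = begin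
    τ n i (p + t * nℤ)   ≡⟨ τ-⁻ i (p + t * nℤ) (trans (res-+*n p t) r≡i⁺) ⟩
    p + t * nℤ - 1ℤ      ≡⟨ +-right-comm p (t * nℤ) ℤ.-1ℤ ⟩
    p ⁻ + t * nℤ         ≡⟨ cong (_+ t * nℤ) eq ⟨
    τ n i p + t * nℤ     ∎
    where open ≡-Reasoning
  ... | fixes (r≢i , r≢i⁺) eq = trans (τ-avoids i (p + t * nℤ) avoids) (cong (_+ t * nℤ) (sym eq))
    where
    avoids : Avoids i (p + t * nℤ)
    avoids = r≢i ∘ trans (sym (res-+*n p t)) , r≢i⁺ ∘ trans (sym (res-+*n p t))

  τ-≤ : ∀ i p → τ n i p ℤ.≤ p ⁺
  τ-≤ i p with τ-view i p
  ... | raises _ eq = ℤₚ.≤-reflexive eq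
  ... | lowers _ eq = ℤₚ.≤-trans (ℤₚ.≤-reflexive eq) (ℤₚ.<⇒≤ (p⁻<p⁺ p))
  ... | fixes _ eq  = ℤₚ.≤-trans (ℤₚ.≤-reflexive eq) (ℤₚ.<⇒≤ (p<p⁺ p))

  τ-≥ : ∀ i p → p ⁻ ℤ.≤ τ n i p
  τ-≥ i p with τ-view i p
  ... | raises _ eq = ℤₚ.≤-trans (ℤₚ.<⇒≤ (p⁻<p⁺ p)) (ℤₚ.≤-reflexive (sym eq))
  ... | lowers _ eq = ℤₚ.≤-reflexive (sym eq)
  ... | fixes _ eq  = ℤₚ.≤-trans (ℤₚ.<⇒≤ (p⁻<p p)) (ℤₚ.≤-reflexive (sym eq))

  τ-raises⇒res : ∀ i p → p ⁺ ℤ.≤ τ n i p → res p ≡ toℕ i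
  τ-raises⇒res i p p⁺≤τp with τ-view i p
  ... | raises r≡i _ = r≡i
  ... | lowers _ eq  = ⊥-elim (ℤₚ.≤⇒≯ (subst (p ⁺ ℤ.≤_) eq p⁺≤τp) (p⁻<p⁺ p))
  ... | fixes _ eq   = ⊥-elim (ℤₚ.≤⇒≯ (subst (p ⁺ ℤ.≤_) eq p⁺≤τp) (p<p⁺ p))

  -- τ moves every position by at most one, so it can only reverse an adjacent pair, and then p
  -- must be raised.
  τ-<-mono : ∀ i {p q} → p < q → ¬ (q ≡ p ⁺ × res p ≡ toℕ i) → τ n i p < τ n i q
  τ-<-mono i {p} {q} p<q ¬swapped with ℤₚ.<-cmp (τ n i p) (τ n i q)
  ... | tri< τp<τq _ _ = τp<τq
  ... | tri≈ _ τp≡τq _ = ⊥-elim (ℤₚ.<-irrefl (τ-injective i τp≡τq) p<q)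
  ... | tri> _ _ τq<τp = ⊥-elim (¬swapped (q≡p⁺ , τ-raises⇒res i p p⁺≤τp))
    where
    τq≤p : τ n i q ℤ.≤ p
    τq≤p = <⁺⇒≤ (ℤₚ.<-≤-trans τq<τp (τ-≤ i p))
    q≡p⁺ : q ≡ p ⁺
    q≡p⁺ = ℤₚ.≤-antisym (subst (ℤ._≤ p ⁺) (⁻⁺ q) (ℤₚ.+-monoˡ-≤ 1ℤ (ℤₚ.≤-trans (τ-≥ i q) τq≤p))) (<⇒⁺≤ p<q)
    τq≡p : τ n i q ≡ p
    τq≡p = ℤₚ.≤-antisym τq≤p (subst (ℤ._≤ τ n i q) (trans (cong _⁻ q≡p⁺) (⁺⁻ p)) (τ-≥ i q))
    p⁺≤τp : p ⁺ ℤ.≤ τ n i p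
    p⁺≤τp = subst (λ r → r ⁺ ℤ.≤ τ n i p) τq≡p (<⇒⁺≤ τq<τp)

  -- Lifted strands

  σ π : Word n → ℤ → ℤ
  σ = state n
  π u = foldl (λ f i → τ n i ∘ f) id u

  σ-∷ʳ : ∀ u i p → σ (u ∷ʳ i) p ≡ σ u (τ n i p)
  σ-∷ʳ u i = cong-app (Listₚ.foldl-∷ʳ (λ f j → f ∘ τ n j) id i u)

  π-∷ʳ : ∀ u i a → π (u ∷ʳ i) a ≡ τ n i (π u a)
  π-∷ʳ u i = cong-app (Listₚ.foldl-∷ʳ (λ f j → τ n j ∘ f) id i u)

  σ∘π≗id : ∀ u → σ u ∘ π u ≗ id
  σ∘π≗id u = go (reverseView u)
    where
    go : ∀ {u} → Reverse u → σ u ∘ π u ≗ id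
    go [] a = refl
    go (u ∶ r ∶ʳ i) a = begin
      σ (u ∷ʳ i) (π (u ∷ʳ i) a)    ≡⟨ σ-∷ʳ u i _ ⟩
      σ u (τ n i (π (u ∷ʳ i) a))   ≡⟨ cong (σ u ∘ τ n i) (π-∷ʳ u i a) ⟩
      σ u (τ n i (τ n i (π u a)))  ≡⟨ cong (σ u) (τ-involutive i (π u a)) ⟩
      σ u (π u a)                  ≡⟨ go r a ⟩
      a                            ∎
      where open ≡-Reasoning

  π∘σ≗id : ∀ u → π u ∘ σ u ≗ id
  π∘σ≗id u = go (reverseView u)
    where
    go : ∀ {u} → Reverse u → π u ∘ σ u ≗ id
    go [] p = refl
    go (u ∶ r ∶ʳ i) p = begin
      π (u ∷ʳ i) (σ (u ∷ʳ i) p)    ≡⟨ π-∷ʳ u i _ ⟩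
      τ n i (π u (σ (u ∷ʳ i) p))   ≡⟨ cong (τ n i ∘ π u) (σ-∷ʳ u i p) ⟩
      τ n i (π u (σ u (τ n i p)))  ≡⟨ cong (τ n i) (go r (τ n i p)) ⟩
      τ n i (τ n i p)              ≡⟨ τ-involutive i p ⟩
      p                            ∎
      where open ≡-Reasoning

  π-injective : ∀ u {a b} → π u a ≡ π u b → a ≡ b
  π-injective u {a} {b} eq = trans (sym (σ∘π≗id u a)) (trans (cong (σ u) eq) (σ∘π≗id u b))

  σ-at : ∀ u {a p} → π u a ≡ p → σ u p ≡ a
  σ-at u {a} eq = trans (cong (σ u) (sym eq)) (σ∘π≗id u a)

  π-σ-∷ʳ : ∀ u i p → π u (σ (u ∷ʳ i) p) ≡ τ n i p
  π-σ-∷ʳ u i p = trans (cong (π u) (σ-∷ʳ u i p)) (π∘σ≗id u (τ n i p))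

  σ-periodic : ∀ u p t → σ u (p + t * nℤ) ≡ σ u p + t * nℤ
  σ-periodic u = go (reverseView u)
    where
    go : ∀ {u} → Reverse u → ∀ p t → σ u (p + t * nℤ) ≡ σ u p + t * nℤ
    go [] p t = refl
    go (u ∶ r ∶ʳ i) p t = begin
      σ (u ∷ʳ i) (p + t * nℤ)   ≡⟨ σ-∷ʳ u i _ ⟩
      σ u (τ n i (p + t * nℤ))  ≡⟨ cong (σ u) (τ-periodic i p t) ⟩
      σ u (τ n i p + t * nℤ)    ≡⟨ go r (τ n i p) t ⟩
      σ u (τ n i p) + t * nℤ    ≡⟨ cong (_+ t * nℤ) (σ-∷ʳ u i p) ⟨
      σ (u ∷ʳ i) p + t * nℤ     ∎
      where open ≡-Reasoning

  π-periodic : ∀ u a t → π u (a + t * nℤ) ≡ π u a + t * nℤ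
  π-periodic u a t = begin
    π u (a + t * nℤ)            ≡⟨ cong (λ b → π u (b + t * nℤ)) (σ∘π≗id u a) ⟨
    π u (σ u (π u a) + t * nℤ)  ≡⟨ cong (π u) (σ-periodic u (π u a) t) ⟨
    π u (σ u (π u a + t * nℤ))  ≡⟨ π∘σ≗id u _ ⟩
    π u a + t * nℤ              ∎
    where open ≡-Reasoning

  -- Crossings and inversions

  data Crosses (u : Word n) (i : Fin n) (a b : ℤ) : Set where
    crosses⁺ : π u b ≡ π u a ⁺ → res (π u a) ≡ toℕ i → Crosses u i a b
    crosses⁻ : π u a ≡ π u b ⁺ → res (π u b) ≡ toℕ i → Crosses u i a b

  crosses-sym : ∀ {u i a b} → Crosses u i a b → Crosses u i b a
  crosses-sym (crosses⁺ eq r≡i) = crosses⁻ eq r≡i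
  crosses-sym (crosses⁻ eq r≡i) = crosses⁺ eq r≡i

  crosses? : ∀ u i a b → Dec (Crosses u i a b)
  crosses? u i a b = map′ Sum.[ uncurry crosses⁺ , uncurry crosses⁻ ] split
    (((π u b ℤₚ.≟ π u a ⁺) ×-dec (res (π u a) ℕₚ.≟ toℕ i)) ⊎-dec
     ((π u a ℤₚ.≟ π u b ⁺) ×-dec (res (π u b) ℕₚ.≟ toℕ i)))
    where
    split : Crosses u i a b → _
    split (crosses⁺ eq r≡i) = inj₁ (eq , r≡i)
    split (crosses⁻ eq r≡i) = inj₂ (eq , r≡i)

  crosses⇒≢ : ∀ {u i a b} → Crosses u i a b → a ≢ b
  crosses⇒≢ {u} {a = a} (crosses⁺ πa≡πa⁺ _) refl = ℤₚ.<-irrefl πa≡πa⁺ (p<p⁺ (π u a))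
  crosses⇒≢ {u} {a = a} (crosses⁻ πa≡πa⁺ _) refl = ℤₚ.<-irrefl πa≡πa⁺ (p<p⁺ (π u a))

  crosses-unique : ∀ {u i a b c} → Crosses u i a b → Crosses u i a c → b ≡ c
  crosses-unique {u} (crosses⁺ πb≡πa⁺ _) (crosses⁺ πc≡πa⁺ _) = π-injective u (trans πb≡πa⁺ (sym πc≡πa⁺))
  crosses-unique {u} (crosses⁻ πa≡πb⁺ _) (crosses⁻ πa≡πc⁺ _) =
    π-injective u (∙-cancelʳ 1ℤ _ _ (trans (sym πa≡πb⁺) πa≡πc⁺))
  crosses-unique {u} {i} {a} {c = c} (crosses⁺ _ r≡i) (crosses⁻ πa≡πc⁺ r′≡i) =
    ⊥-elim (next-toℕ-≢ i (begin
      next (toℕ i)        ≡⟨ cong next r′≡i ⟨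
      next (res (π u c))  ≡⟨ res-⁺ (π u c) ⟨
      res (π u c ⁺)       ≡⟨ cong res πa≡πc⁺ ⟨
      res (π u a)         ≡⟨ r≡i ⟩
      toℕ i               ∎))
    where open ≡-Reasoning
  crosses-unique ab@(crosses⁻ _ _) ac@(crosses⁺ _ _) = sym (crosses-unique ac ab)

  avoids⇒¬crosses : ∀ {u i a b} → Avoids i (π u a) → ¬ Crosses u i a b
  avoids⇒¬crosses (r≢i , _) (crosses⁺ _ r≡i) = r≢i r≡i
  avoids⇒¬crosses {u} {b = b} (_ , r≢i⁺) (crosses⁻ πa≡πb⁺ r≡i) =
    r≢i⁺ (trans (cong res πa≡πb⁺) (trans (res-⁺ (π u b)) (cong next r≡i)))

  lift : Fin n → ℤ → ℤ
  lift i t = + toℕ i + t * nℤ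

  lift-⁺ : ∀ i t → + toℕ i + 1ℤ + t * nℤ ≡ lift i t ⁺
  lift-⁺ i t = +-right-comm (+ toℕ i) 1ℤ (t * nℤ)

  positions-of-crossing : ∀ u {i t a b} → σ u (lift i t) ≡ a → σ u (+ toℕ i + 1ℤ + t * nℤ) ≡ b →
                          π u b ≡ π u a ⁺ × res (π u a) ≡ toℕ i
  positions-of-crossing u {i} {t} refl refl =
    trans (π∘σ≗id u _) (trans (lift-⁺ i t) (cong _⁺ (sym (π∘σ≗id u _)))) ,
    trans (cong res (π∘σ≗id u _)) (res-unique t (Finₚ.toℕ<n i))

  strands-of-crossing : ∀ u {i a b} → π u b ≡ π u a ⁺ → res (π u a) ≡ toℕ i →
                        let t = π u a /ℕ n in σ u (lift i t) ≡ a × σ u (+ toℕ i + 1ℤ + t * nℤ) ≡ b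
  strands-of-crossing u {i} {a} {b} πb≡πa⁺ r≡i = σ-at u πa≡lift , σ-at u πb≡lift⁺
    where
    t : ℤ
    t = π u a /ℕ n
    πa≡lift : π u a ≡ lift i t
    πa≡lift = trans (res-decomposition (π u a)) (cong (λ j → + j + t * nℤ) r≡i)
    πb≡lift⁺ : π u b ≡ + toℕ i + 1ℤ + t * nℤ
    πb≡lift⁺ = trans πb≡πa⁺ (trans (cong _⁺ πa≡lift) (sym (lift-⁺ i t)))

  crossingOf⇒crosses : ∀ {u i a b} → CrossingOf n u i a b → Crosses u i a b
  crossingOf⇒crosses {u} (t , inj₁ (ea , eb)) = uncurry crosses⁺ (positions-of-crossing u {t = t} ea eb)
  crossingOf⇒crosses {u} (t , inj₂ (eb , ea)) = uncurry crosses⁻ (positions-of-crossing u {t = t} eb ea)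

  crosses⇒crossingOf : ∀ {u i a b} → Crosses u i a b → CrossingOf n u i a b
  crosses⇒crossingOf {u} {a = a} (crosses⁺ πb≡πa⁺ r≡i) =
    π u a /ℕ n , inj₁ (strands-of-crossing u πb≡πa⁺ r≡i)
  crosses⇒crossingOf {u} {b = b} (crosses⁻ πa≡πb⁺ r≡i) =
    π u b /ℕ n , inj₂ (strands-of-crossing u πa≡πb⁺ r≡i)

  data Inverted (u : Word n) (a b : ℤ) : Set where
    inverted< : a < b → π u b < π u a → Inverted u a b
    inverted> : b < a → π u a < π u b → Inverted u a b

  inverted-sym : ∀ {u a b} → Inverted u a b → Inverted u b a
  inverted-sym (inverted< a<b πb<πa) = inverted> a<b πb<πa
  inverted-sym (inverted> b<a πa<πb) = inverted< b<a πa<πb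

  inverted? : ∀ u a b → Dec (Inverted u a b)
  inverted? u a b = map′ Sum.[ uncurry inverted< , uncurry inverted> ] split
    (((a ℤₚ.<? b) ×-dec (π u b ℤₚ.<? π u a)) ⊎-dec ((b ℤₚ.<? a) ×-dec (π u a ℤₚ.<? π u b)))
    where
    split : Inverted u a b → _
    split (inverted< a<b πb<πa) = inj₁ (a<b , πb<πa)
    split (inverted> b<a πa<πb) = inj₂ (b<a , πa<πb)

  ¬inverted-[] : ∀ {a b} → ¬ Inverted [] a b
  ¬inverted-[] (inverted< a<b b<a) = ℤₚ.<-asym a<b b<a
  ¬inverted-[] (inverted> b<a a<b) = ℤₚ.<-asym a<b b<a

  inverted⇒≢ : ∀ {u a b} → Inverted u a b → a ≢ b
  inverted⇒≢ (inverted< a<b _) a≡b = ℤₚ.<-irrefl a≡b a<b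
  inverted⇒≢ (inverted> b<a _) a≡b = ℤₚ.<-irrefl (sym a≡b) b<a

  inverted⇒> : ∀ {u a b} → π u a < π u b → Inverted u a b → b < a
  inverted⇒> πa<πb (inverted< _ πb<πa) = ⊥-elim (ℤₚ.<-asym πa<πb πb<πa)
  inverted⇒> πa<πb (inverted> b<a _)   = b<a

  ¬inverted⇒< : ∀ {u a b} → π u a < π u b → ¬ Inverted u a b → a < b
  ¬inverted⇒< {u} {a} {b} πa<πb ¬inv with ℤₚ.<-cmp a b
  ... | tri< a<b _ _  = a<b
  ... | tri≈ _ refl _ = ⊥-elim (ℤₚ.<-irrefl refl πa<πb)
  ... | tri> _ _ b<a  = ⊥-elim (¬inv (inverted> b<a πa<πb))

  π-σ-< : ∀ u {p q} → p < q → π u (σ u p) < π u (σ u q)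
  π-σ-< u {p} {q} = subst₂ _<_ (sym (π∘σ≗id u p)) (sym (π∘σ≗id u q))

  inverted-at⇒> : ∀ u {p q} → p < q → Inverted u (σ u p) (σ u q) → σ u q < σ u p
  inverted-at⇒> u p<q = inverted⇒> (π-σ-< u p<q)

  ¬inverted-at⇒< : ∀ u {p q} → p < q → ¬ Inverted u (σ u p) (σ u q) → σ u p < σ u q
  ¬inverted-at⇒< u p<q = ¬inverted⇒< (π-σ-< u p<q)

  >⇒inverted-at : ∀ u {p q} → p < q → σ u q < σ u p → Inverted u (σ u p) (σ u q)
  >⇒inverted-at u p<q σq<σp = inverted> σq<σp (π-σ-< u p<q)

  inverted-at⇒≢ : ∀ u {p q} → Inverted u (σ u p) (σ u q) → q ≢ p
  inverted-at⇒≢ u inv refl = inverted⇒≢ inv refl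

  inverted-+*n : ∀ {u a b} t → Inverted u (a + t * nℤ) (b + t * nℤ) → Inverted u a b
  inverted-+*n {u} {a} {b} t (inverted< a<b πb<πa) =
    inverted< (+-cancelʳ-< (t * nℤ) a<b)
              (+-cancelʳ-< (t * nℤ) (subst₂ _<_ (π-periodic u b t) (π-periodic u a t) πb<πa))
  inverted-+*n {u} {a} {b} t (inverted> b<a πa<πb) =
    inverted> (+-cancelʳ-< (t * nℤ) b<a)
              (+-cancelʳ-< (t * nℤ) (subst₂ _<_ (π-periodic u a t) (π-periodic u b t) πa<πb))

  π-∷ʳ-<-mono : ∀ {u i a b} → ¬ Crosses u i a b → π u a < π u b → π (u ∷ʳ i) a < π (u ∷ʳ i) b
  π-∷ʳ-<-mono {u} {i} {a} {b} ¬c πa<πb =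
    subst₂ _<_ (sym (π-∷ʳ u i a)) (sym (π-∷ʳ u i b)) (τ-<-mono i πa<πb (¬c ∘ uncurry crosses⁺))

  π-∷ʳ-<-reflect : ∀ {u i a b} → ¬ Crosses u i a b → π (u ∷ʳ i) a < π (u ∷ʳ i) b → π u a < π u b
  π-∷ʳ-<-reflect {u} {i} {a} {b} ¬c π′a<π′b with ℤₚ.<-cmp (π u a) (π u b)
  ... | tri< πa<πb _ _ = πa<πb
  ... | tri≈ _ πa≡πb _ = ⊥-elim (ℤₚ.<-irrefl (cong (π (u ∷ʳ i)) (π-injective u πa≡πb)) π′a<π′b)
  ... | tri> _ _ πb<πa = ⊥-elim (ℤₚ.<-asym π′a<π′b (π-∷ʳ-<-mono (¬c ∘ crosses-sym) πb<πa))

  inverted-∷ʳ⁺ : ∀ {u i a b} → ¬ Crosses u i a b → Inverted u a b → Inverted (u ∷ʳ i) a b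
  inverted-∷ʳ⁺ ¬c (inverted< a<b πb<πa) = inverted< a<b (π-∷ʳ-<-mono (¬c ∘ crosses-sym) πb<πa)
  inverted-∷ʳ⁺ ¬c (inverted> b<a πa<πb) = inverted> b<a (π-∷ʳ-<-mono ¬c πa<πb)

  inverted-∷ʳ⁻ : ∀ {u i a b} → ¬ Crosses u i a b → Inverted (u ∷ʳ i) a b → Inverted u a b
  inverted-∷ʳ⁻ ¬c (inverted< a<b π′b<π′a) = inverted< a<b (π-∷ʳ-<-reflect (¬c ∘ crosses-sym) π′b<π′a)
  inverted-∷ʳ⁻ ¬c (inverted> b<a π′a<π′b) = inverted> b<a (π-∷ʳ-<-reflect ¬c π′a<π′b)

  crosses⇒inverted-∷ʳ : ∀ {u i a b} → Crosses u i a b → ¬ Inverted u a b → Inverted (u ∷ʳ i) a b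
  crosses⇒inverted-∷ʳ {u} {i} {a} {b} (crosses⁺ πb≡πa⁺ r≡i) ¬inv =
    inverted< (¬inverted⇒< πa<πb ¬inv) (subst₂ _<_ (sym π′b≡πa) (sym π′a≡πa⁺) (p<p⁺ (π u a)))
    where
    πa<πb : π u a < π u b
    πa<πb = subst (π u a <_) (sym πb≡πa⁺) (p<p⁺ (π u a))
    π′a≡πa⁺ : π (u ∷ʳ i) a ≡ π u a ⁺
    π′a≡πa⁺ = trans (π-∷ʳ u i a) (proj₁ (τ-swaps i (π u a) r≡i))
    π′b≡πa : π (u ∷ʳ i) b ≡ π u a
    π′b≡πa = trans (π-∷ʳ u i b) (trans (cong (τ n i) πb≡πa⁺) (proj₂ (τ-swaps i (π u a) r≡i)))
  crosses⇒inverted-∷ʳ c@(crosses⁻ _ _) ¬inv =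
    inverted-sym (crosses⇒inverted-∷ʳ (crosses-sym c) (¬inv ∘ inverted-sym))

  inverted-∷ʳ⇒crosses : ∀ {u i a b} → Inverted (u ∷ʳ i) a b → ¬ Inverted u a b → Crosses u i a b
  inverted-∷ʳ⇒crosses {u} {i} {a} {b} inv ¬inv with crosses? u i a b
  ... | yes c = c
  ... | no ¬c = ⊥-elim (¬inv (inverted-∷ʳ⁻ ¬c inv))

  -- Bigons and triangles

  NoBigon NoTriangle : Word n → Set
  NoBigon w    = ¬ HasContractibleBigon n w
  NoTriangle w = ¬ HasContractibleTriangle n w

  ++-assoc-∷ : ∀ (u : Word n) i v z → (u ++ i ∷ v) ++ z ≡ u ++ i ∷ (v ++ z)
  ++-assoc-∷ u i v = Listₚ.++-assoc u (i ∷ v)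

  ++-assoc-∷² : ∀ (u : Word n) i v j x z → (u ++ i ∷ v ++ j ∷ x) ++ z ≡ u ++ i ∷ v ++ j ∷ (x ++ z)
  ++-assoc-∷² u i v j x z =
    trans (++-assoc-∷ u i (v ++ j ∷ x) z) (cong (λ t → u ++ i ∷ t) (++-assoc-∷ v j x z))

  ++-assoc-∷³ : ∀ (u : Word n) i v j x k y z →
                (u ++ i ∷ v ++ j ∷ x ++ k ∷ y) ++ z ≡ u ++ i ∷ v ++ j ∷ x ++ k ∷ (y ++ z)
  ++-assoc-∷³ u i v j x k y z =
    trans (++-assoc-∷² u i v j (x ++ k ∷ y) z) (cong (λ t → u ++ i ∷ v ++ j ∷ t) (++-assoc-∷ x k y z))

  bigon-++ : ∀ {w} z → HasContractibleBigon n w → HasContractibleBigon n (w ++ z)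
  bigon-++ z (u , i , v , j , x , refl , crossings) =
    u , i , v , j , x ++ z , ++-assoc-∷² u i v j x z , crossings

  triangle-++ : ∀ {w} z → HasContractibleTriangle n w → HasContractibleTriangle n (w ++ z)
  triangle-++ z (u , i , v , j , x , k , y , refl , crossings) =
    u , i , v , j , x , k , y ++ z , ++-assoc-∷³ u i v j x k y z , crossings

  web-∷ʳ⁻ : ∀ {w x} → IsWeb n (w ∷ʳ x) → IsWeb n w
  web-∷ʳ⁻ {x = x} (nb , nt) = nb ∘ bigon-++ [ x ] , nt ∘ triangle-++ [ x ]

  web-[] : IsWeb n []
  web-[] = (λ (u , _ , _ , _ , _ , eq , _) → []≢++∷ u eq) ,
           (λ (u , _ , _ , _ , _ , _ , _ , eq , _) → []≢++∷ u eq)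
    where
    []≢++∷ : ∀ (u : Word n) {i v} → [] ≢ u ++ i ∷ v
    []≢++∷ []      ()
    []≢++∷ (_ ∷ _) ()

  Crossed : Word n → ℤ → ℤ → Set
  Crossed w a b = ∃[ u ] ∃[ i ] ∃[ v ] (w ≡ u ++ i ∷ v × Crosses u i a b)

  inverted⇒crossed : ∀ w {a b} → Inverted w a b → Crossed w a b
  inverted⇒crossed w = go (reverseView w)
    where
    go : ∀ {w a b} → Reverse w → Inverted w a b → Crossed w a b
    go [] inv = ⊥-elim (¬inverted-[] inv)
    go {a = a} {b} (w ∶ r ∶ʳ x) inv with inverted? w a b
    ... | no ¬inv = w , x , [] , refl , inverted-∷ʳ⇒crosses inv ¬inv
    ... | yes inv′ with go r inv′
    ...   | u , i , v , refl , c = u , i , v ∷ʳ x , ++-assoc-∷ u i v [ x ] , c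

  crossed⇒inverted : ∀ {u i v a b} → NoBigon (u ++ i ∷ v) → Crosses u i a b → Inverted (u ++ i ∷ v) a b
  crossed⇒inverted {u} {i} {v} {a} {b} nb c = go (reverseView v) nb
    where
    go : ∀ {v} → Reverse v → NoBigon (u ++ i ∷ v) → Inverted (u ++ i ∷ v) a b
    go [] nb with inverted? u a b
    ... | no ¬inv = crosses⇒inverted-∷ʳ c ¬inv
    ... | yes inv with inverted⇒crossed u inv
    ...   | u₀ , i₀ , v₀ , u≡ , c₀ = ⊥-elim (nb (u₀ , i₀ , v₀ , i , [] ,
              trans (cong (_∷ʳ i) u≡) (++-assoc-∷ u₀ i₀ v₀ [ i ]) , a , b ,
              crosses⇒crossingOf c₀ , crosses⇒crossingOf (subst (λ t → Crosses t i a b) u≡ c)))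
    go (v ∶ r ∶ʳ y) nb with crosses? (u ++ i ∷ v) y a b
    ... | yes c′ =
      ⊥-elim (nb (u , i , v , y , [] , refl , a , b , crosses⇒crossingOf c , crosses⇒crossingOf c′))
    ... | no ¬c′ = subst (λ w → Inverted w a b) (++-assoc-∷ u i v [ y ]) (inverted-∷ʳ⁺ ¬c′ (go r nb′))
      where
      nb′ : NoBigon (u ++ i ∷ v)
      nb′ = nb ∘ subst (HasContractibleBigon n) (++-assoc-∷ u i v [ y ]) ∘ bigon-++ [ y ]

  CrossedInOrder : Word n → ℤ → ℤ → ℤ → ℤ → Set
  CrossedInOrder w a b c d = ∃[ u ] ∃[ i ] ∃[ v ] ∃[ j ] ∃[ y ]
    (w ≡ u ++ i ∷ v ++ j ∷ y × Crosses u i a b × Crosses (u ++ i ∷ v) j c d)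

  crossedInOrder-sym : ∀ {w a b c d} → CrossedInOrder w a b c d → CrossedInOrder w b a d c
  crossedInOrder-sym (u , i , v , j , y , eq , ab , cd) =
    u , i , v , j , y , eq , crosses-sym ab , crosses-sym cd

  crossedInOrder-∷ʳ : ∀ {w x a b c d} → CrossedInOrder w a b c d → CrossedInOrder (w ∷ʳ x) a b c d
  crossedInOrder-∷ʳ {x = x} (u , i , v , j , y , refl , ab , cd) =
    u , i , v , j , y ∷ʳ x , ++-assoc-∷² u i v j y [ x ] , ab , cd

  crossed-then : ∀ {w x a b c d} → Crossed w a b → Crosses w x c d → CrossedInOrder (w ∷ʳ x) a b c d
  crossed-then {x = x} (u , i , v , refl , ab) cd = u , i , v , x , [] , ++-assoc-∷ u i v [ x ] , ab , cd

  inversions⇒crossedInOrder : ∀ w {a b c} → a ≢ c → Inverted w a b → Inverted w b c →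
                              CrossedInOrder w a b b c ⊎ CrossedInOrder w b c a b
  inversions⇒crossedInOrder w = go (reverseView w)
    where
    go : ∀ {w a b c} → Reverse w → a ≢ c → Inverted w a b → Inverted w b c →
         CrossedInOrder w a b b c ⊎ CrossedInOrder w b c a b
    go [] _ iab _ = ⊥-elim (¬inverted-[] iab)
    go {a = a} {b} {c} (w ∶ r ∶ʳ x) a≢c iab ibc with inverted? w a b | inverted? w b c
    ... | yes iab′ | yes ibc′ = Sum.map crossedInOrder-∷ʳ crossedInOrder-∷ʳ (go r a≢c iab′ ibc′)
    ... | yes iab′ | no ¬ibc  = inj₁ (crossed-then (inverted⇒crossed w iab′) (inverted-∷ʳ⇒crosses ibc ¬ibc))
    ... | no ¬iab  | _        = inj₂ (crossed-then (inverted⇒crossed w ibc′) xab)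
      where
      xab : Crosses w x a b
      xab = inverted-∷ʳ⇒crosses iab ¬iab
      ibc′ : Inverted w b c
      ibc′ = inverted-∷ʳ⁻ (λ xbc → a≢c (crosses-unique (crosses-sym xab) xbc)) ibc

  triangle-∷ʳ : ∀ {w x a b c} → CrossedInOrder w a b b c → Crosses w x a c →
                HasContractibleTriangle n (w ∷ʳ x)
  triangle-∷ʳ {x = x} {a} {b} {c} (u , i , v , j , y , refl , ab , bc) ac =
    u , i , v , j , y , x , [] , ++-assoc-∷² u i v j y [ x ] , a , b , c ,
    crosses⇒crossingOf ab , crosses⇒crossingOf bc , crosses⇒crossingOf ac

  crosses-inverted-pair⇒triangle : ∀ {w x a b c} → Inverted w a b → Inverted w b c → Crosses w x a c →
                                   HasContractibleTriangle n (w ∷ʳ x)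
  crosses-inverted-pair⇒triangle {w} iab ibc xac with inversions⇒crossedInOrder w (crosses⇒≢ xac) iab ibc
  ... | inj₁ ab-then-bc = triangle-∷ʳ ab-then-bc xac
  ... | inj₂ bc-then-ab = triangle-∷ʳ (crossedInOrder-sym bc-then-ab) (crosses-sym xac)

  inversions⇒triangle : ∀ w {a b c} → Inverted w a b → Inverted w b c → Inverted w a c →
                        HasContractibleTriangle n w
  inversions⇒triangle w = go (reverseView w)
    where
    go : ∀ {w a b c} → Reverse w → Inverted w a b → Inverted w b c → Inverted w a c →
         HasContractibleTriangle n w
    go [] iab _ _ = ⊥-elim (¬inverted-[] iab)
    go {a = a} {b} {c} (w ∶ r ∶ʳ x) iab ibc iac with inverted? w a b | inverted? w b c | inverted? w a c
    ... | yes iab′ | yes ibc′ | yes iac′ = triangle-++ [ x ] (go r iab′ ibc′ iac′)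
    ... | _        | _        | no ¬iac  =
      crosses-inverted-pair⇒triangle (inverted-∷ʳ⁻ ¬xab iab) (inverted-∷ʳ⁻ ¬xbc ibc) xac
      where
      xac : Crosses w x a c
      xac = inverted-∷ʳ⇒crosses iac ¬iac
      ¬xab : ¬ Crosses w x a b
      ¬xab xab = inverted⇒≢ ibc (crosses-unique xab xac)
      ¬xbc : ¬ Crosses w x b c
      ¬xbc xbc = inverted⇒≢ iab (crosses-unique (crosses-sym xac) (crosses-sym xbc))
    ... | no ¬iab  | _        | yes iac′ =
      crosses-inverted-pair⇒triangle iac′ (inverted-sym (inverted-∷ʳ⁻ ¬xbc ibc)) xab
      where
      xab : Crosses w x a b
      xab = inverted-∷ʳ⇒crosses iab ¬iab
      ¬xbc : ¬ Crosses w x b c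
      ¬xbc xbc = inverted⇒≢ iac (crosses-unique (crosses-sym xab) xbc)
    ... | yes iab′ | no ¬ibc  | yes iac′ =
      crosses-inverted-pair⇒triangle (inverted-sym iab′) iac′ (inverted-∷ʳ⇒crosses ibc ¬ibc)

  -- Disks closed by a crossing on top of a web

  -- A crossing of a and b placed on top of w would close a contractible bigon or triangle.
  Disk : Word n → ℤ → ℤ → Set
  Disk w a b = Inverted w a b ⊎ ∃[ c ] (Inverted w a c × Inverted w b c)

  ClosesDisk : Word n → ℤ → Set
  ClosesDisk w P = Disk w (σ w P) (σ w (P ⁺))

  disk-sym : ∀ {w a b} → Disk w a b → Disk w b a
  disk-sym (inj₁ iab)             = inj₁ (inverted-sym iab)
  disk-sym (inj₂ (c , iac , ibc)) = inj₂ (c , ibc , iac)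

  ¬disk-[] : ∀ {a b} → ¬ Disk [] a b
  ¬disk-[] (inj₁ iab)           = ¬inverted-[] iab
  ¬disk-[] (inj₂ (_ , iac , _)) = ¬inverted-[] iac

  disk-+*n : ∀ {w a b} t → Disk w (a + t * nℤ) (b + t * nℤ) → Disk w a b
  disk-+*n t (inj₁ iab) = inj₁ (inverted-+*n t iab)
  disk-+*n {w} t (inj₂ (c , iac , ibc)) =
    inj₂ (c - t * nℤ , inverted-+*n t (subst (Inverted w _) c≡ iac) ,
                       inverted-+*n t (subst (Inverted w _) c≡ ibc))
    where
    c≡ : c ≡ c - t * nℤ + t * nℤ
    c≡ = ring c (t * nℤ) where ring : ∀ c s → c ≡ c - s + s ; ring = solve-∀

  crossingOf⇒closesDisk : ∀ {w k a b} → CrossingOf n w k a b → Disk w a b → ClosesDisk w (+ toℕ k)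
  crossingOf⇒closesDisk {w} (t , inj₁ (ea , eb)) d =
    disk-+*n t (subst₂ (Disk w) (trans (sym ea) (σ-periodic w _ t)) (trans (sym eb) (σ-periodic w _ t)) d)
  crossingOf⇒closesDisk {w} (t , inj₂ (eb , ea)) d =
    disk-+*n t (subst₂ (Disk w) (trans (sym eb) (σ-periodic w _ t)) (trans (sym ea) (σ-periodic w _ t))
                                (disk-sym d))

  ∷ʳ-split : ∀ (w L : Word n) {k j x} → w ∷ʳ k ≡ L ++ j ∷ x → (L ≡ w × j ≡ k) ⊎ ∃[ x′ ] (w ≡ L ++ j ∷ x′)
  ∷ʳ-split w L {k} {j} {x} eq with reverseView x
  ... | []          = inj₁ (Product.map sym sym (Listₚ.∷ʳ-injective w L eq))
  ... | x′ ∶ _ ∶ʳ y =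
    inj₂ (x′ , proj₁ (Listₚ.∷ʳ-injective w (L ++ j ∷ x′) (trans eq (sym (++-assoc-∷ L j x′ [ y ])))))

  bigon-∷ʳ⇒closesDisk : ∀ {w k} → NoBigon w → HasContractibleBigon n (w ∷ʳ k) → ClosesDisk w (+ toℕ k)
  bigon-∷ʳ⇒closesDisk {w} nb (u , i , v , j , x , eq , a , b , ab , ab′)
    with ∷ʳ-split w (u ++ i ∷ v) (trans eq (sym (++-assoc-∷ u i v (j ∷ x))))
  ... | inj₁ (refl , refl) = crossingOf⇒closesDisk ab′ (inj₁ (crossed⇒inverted nb (crossingOf⇒crosses ab)))
  ... | inj₂ (x′ , w≡)     =
    ⊥-elim (nb (u , i , v , j , x′ , trans w≡ (++-assoc-∷ u i v (j ∷ x′)) , a , b , ab , ab′))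

  triangle-∷ʳ⇒closesDisk : ∀ {w k} → IsWeb n w → HasContractibleTriangle n (w ∷ʳ k) → ClosesDisk w (+ toℕ k)
  triangle-∷ʳ⇒closesDisk {w} (nb , nt) (u , i , v , j , x , k′ , y , eq , a , b , c , ab , bc , ac)
    with ∷ʳ-split w (u ++ i ∷ v ++ j ∷ x) (trans eq (sym (++-assoc-∷² u i v j x (k′ ∷ y))))
  ... | inj₁ (refl , refl) = crossingOf⇒closesDisk ac (inj₂ (b , iab , inverted-sym ibc))
    where
    regroup : u ++ i ∷ v ++ j ∷ x ≡ (u ++ i ∷ v) ++ j ∷ x
    regroup = sym (++-assoc-∷ u i v (j ∷ x))
    iab : Inverted (u ++ i ∷ v ++ j ∷ x) a b
    iab = crossed⇒inverted nb (crossingOf⇒crosses ab)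
    ibc : Inverted (u ++ i ∷ v ++ j ∷ x) b c
    ibc = subst (λ w → Inverted w b c) (sym regroup)
            (crossed⇒inverted (subst NoBigon regroup nb) (crossingOf⇒crosses bc))
  ... | inj₂ (y′ , w≡) = ⊥-elim (nt (u , i , v , j , x , k′ , y′ ,
                           trans w≡ (++-assoc-∷² u i v j x (k′ ∷ y′)) , a , b , c , ab , bc , ac))

  web-∷ʳ : ∀ {w k} → IsWeb n w → ¬ ClosesDisk w (+ toℕ k) → IsWeb n (w ∷ʳ k)
  web-∷ʳ web@(nb , _) ¬closes = ¬closes ∘ bigon-∷ʳ⇒closesDisk nb , ¬closes ∘ triangle-∷ʳ⇒closesDisk web

  inverted-σ∘π : ∀ u {a c} → Inverted u a c → Inverted u a (σ u (π u c))
  inverted-σ∘π u {a} {c} = subst (Inverted u a) (sym (σ∘π≗id u c))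

  -- Strands s₀ s₁ s₂ at the positions Q, Q + 1, Q + 2 with s₁, s₂ inverted: a strand inverted
  -- with both s₀ and s₁ would form a triangle with s₁ and s₂.
  disk-left : ∀ {w} Q → NoTriangle w → Inverted w (σ w (Q ⁺)) (σ w (Q ⁺ ⁺)) →
              Disk w (σ w Q) (σ w (Q ⁺)) → Inverted w (σ w Q) (σ w (Q ⁺ ⁺))
  disk-left {w} Q nt i₁₂ d with inverted? w (σ w Q) (σ w (Q ⁺ ⁺))
  ... | yes i₀₂ = i₀₂
  ... | no ¬i₀₂ = ⊥-elim (impossible d)
    where
    s₂<s₁ : σ w (Q ⁺ ⁺) < σ w (Q ⁺)
    s₂<s₁ = inverted-at⇒> w (p<p⁺ (Q ⁺)) i₁₂
    s₀<s₂ : σ w Q < σ w (Q ⁺ ⁺)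
    s₀<s₂ = ¬inverted-at⇒< w (p<p⁺⁺ Q) ¬i₀₂
    third : ∀ q → Inverted w (σ w Q) (σ w q) → Inverted w (σ w (Q ⁺)) (σ w q) → ⊥
    third q i₀q i₁q with ℤₚ.<-cmp q (Q ⁺ ⁺)
    ... | tri≈ _ refl _  = ¬i₀₂ i₀q
    ... | tri< q<Q⁺⁺ _ _ = nt (inversions⇒triangle w i₁₂ (inverted-sym iq₂) i₁q)
      where
      q<Q⁺ : q < Q ⁺
      q<Q⁺ = ℤₚ.≤∧≢⇒< (<⁺⇒≤ q<Q⁺⁺) (inverted-at⇒≢ w i₁q)
      iq₂ : Inverted w (σ w q) (σ w (Q ⁺ ⁺))
      iq₂ = >⇒inverted-at w q<Q⁺⁺ (ℤₚ.<-trans s₂<s₁ (inverted-at⇒> w q<Q⁺ (inverted-sym i₁q)))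
    ... | tri> _ _ Q⁺⁺<q = nt (inversions⇒triangle w i₁₂ i₂q i₁q)
      where
      i₂q : Inverted w (σ w (Q ⁺ ⁺)) (σ w q)
      i₂q = >⇒inverted-at w Q⁺⁺<q (ℤₚ.<-trans (inverted-at⇒> w (ℤₚ.<-trans (p<p⁺⁺ Q) Q⁺⁺<q) i₀q) s₀<s₂)
    impossible : Disk w (σ w Q) (σ w (Q ⁺)) → ⊥
    impossible (inj₁ i₀₁)             = <-cycle (inverted-at⇒> w (p<p⁺ Q) i₀₁) s₀<s₂ s₂<s₁
    impossible (inj₂ (c , i₀c , i₁c)) = third (π w c) (inverted-σ∘π w i₀c) (inverted-σ∘π w i₁c)

  disk-right : ∀ {w} Q → NoTriangle w → Inverted w (σ w (Q ⁻)) (σ w Q) →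
               Disk w (σ w Q) (σ w (Q ⁺)) → Inverted w (σ w (Q ⁻)) (σ w (Q ⁺))
  disk-right {w} Q nt i₋₀ d with inverted? w (σ w (Q ⁻)) (σ w (Q ⁺))
  ... | yes i₋₊ = i₋₊
  ... | no ¬i₋₊ = ⊥-elim (impossible d)
    where
    s₀<s₋ : σ w Q < σ w (Q ⁻)
    s₀<s₋ = inverted-at⇒> w (p⁻<p Q) i₋₀
    s₋<s₊ : σ w (Q ⁻) < σ w (Q ⁺)
    s₋<s₊ = ¬inverted-at⇒< w (p⁻<p⁺ Q) ¬i₋₊
    third : ∀ q → Inverted w (σ w Q) (σ w q) → Inverted w (σ w (Q ⁺)) (σ w q) → ⊥
    third q i₀q i₊q with ℤₚ.<-cmp q (Q ⁻)
    ... | tri≈ _ refl _ = ¬i₋₊ (inverted-sym i₊q)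
    ... | tri< q<Q⁻ _ _ = nt (inversions⇒triangle w i₋₀ i₀q (inverted-sym iq₋))
      where
      iq₋ : Inverted w (σ w q) (σ w (Q ⁻))
      iq₋ = >⇒inverted-at w q<Q⁻
              (ℤₚ.<-trans s₋<s₊ (inverted-at⇒> w (ℤₚ.<-trans q<Q⁻ (p⁻<p⁺ Q)) (inverted-sym i₊q)))
    ... | tri> _ _ Q⁻<q = nt (inversions⇒triangle w i₋₀ i₀q i₋q)
      where
      Q<q : Q < q
      Q<q = ℤₚ.≤∧≢⇒< (subst (ℤ._≤ q) (⁻⁺ Q) (<⇒⁺≤ Q⁻<q)) (inverted-at⇒≢ w i₀q ∘ sym)
      i₋q : Inverted w (σ w (Q ⁻)) (σ w q)
      i₋q = >⇒inverted-at w Q⁻<q (ℤₚ.<-trans (inverted-at⇒> w Q<q i₀q) s₀<s₋)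
    impossible : Disk w (σ w Q) (σ w (Q ⁺)) → ⊥
    impossible (inj₁ i₀₊)             = <-cycle (inverted-at⇒> w (p<p⁺ Q) i₀₊) s₀<s₋ s₋<s₊
    impossible (inj₂ (c , i₀c , i₊c)) = third (π w c) (inverted-σ∘π w i₀c) (inverted-σ∘π w i₊c)

  -- For n = 2 the strands at positions p and p + 2 are translates of each other, so never inverted.
  inverted-at-distance-2⇒3≤n : ∀ w {p q} → q ≡ p ⁺ ⁺ → Inverted w (σ w p) (σ w q) → 3 ≤ n
  inverted-at-distance-2⇒3≤n w {p} refl inv with m ℕₚ.≟ 0
  ... | no m≢0  = s≤s (s≤s (ℕₚ.n≢0⇒n>0 m≢0))
  ... | yes m≡0 = ⊥-elim (ℤₚ.<-asym (inverted-at⇒> w (p<p⁺⁺ p) inv) σp<σp⁺⁺)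
    where
    period : ∀ p → p ⁺ ⁺ ≡ p + 1ℤ * nℤ
    period p = subst (λ k → p ⁺ ⁺ ≡ p + 1ℤ * + suc (suc k)) (sym m≡0) (ℤₚ.+-assoc p 1ℤ 1ℤ)
    σp<σp⁺⁺ : σ w p < σ w (p ⁺ ⁺)
    σp<σp⁺⁺ = subst (σ w p <_) (sym σ-⁺⁺) (p<p⁺⁺ (σ w p))
      where
      open ≡-Reasoning
      σ-⁺⁺ : σ w (p ⁺ ⁺) ≡ σ w p ⁺ ⁺
      σ-⁺⁺ = begin
        σ w (p ⁺ ⁺)           ≡⟨ cong (σ w) (period p) ⟩
        σ w (p + 1ℤ * nℤ)     ≡⟨ σ-periodic w p 1ℤ ⟩
        σ w p + 1ℤ * nℤ       ≡⟨ period (σ w p) ⟨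
        σ w p ⁺ ⁺             ∎

  -- Pushing a new letter down a web

  data Adjacency (k : Fin n) : Fin n → Set where
    equal : Adjacency k k
    above : ∀ {x} → Next n k x → Adjacency k x
    below : ∀ {x} → Next n x k → Adjacency k x
    far   : ∀ {x} → FarApart n k x → Adjacency k x

  adjacency : ∀ k x → Adjacency k x
  adjacency k x with k Finₚ.≟ x
  ... | yes refl = equal
  ... | no k≢x with next (toℕ k) ℕₚ.≟ toℕ x
  ...   | yes k⁺≡x = above k⁺≡x
  ...   | no k⁺≢x with next (toℕ x) ℕₚ.≟ toℕ k
  ...     | yes x⁺≡k = below x⁺≡k
  ...     | no x⁺≢k  = far (k≢x ∘ Finₚ.toℕ-injective , k⁺≢x , x⁺≢k)

  σ-∷ʳ-avoids : ∀ w₀ {x p} → Avoids x p → σ (w₀ ∷ʳ x) p ≡ σ w₀ p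
  σ-∷ʳ-avoids w₀ {x} {p} av = trans (σ-∷ʳ w₀ x p) (cong (σ w₀) (τ-avoids x p av))

  ¬crosses-avoids : ∀ w₀ {x p b} → Avoids x p → ¬ Crosses w₀ x (σ (w₀ ∷ʳ x) p) b
  ¬crosses-avoids w₀ {x} {p} av =
    avoids⇒¬crosses (subst (Avoids x) (sym (trans (π-σ-∷ʳ w₀ x p) (τ-avoids x p av))) av)

  inverted-∷ʳ-avoids : ∀ w₀ {x p q} → Avoids x p → Inverted (w₀ ∷ʳ x) (σ (w₀ ∷ʳ x) p) (σ (w₀ ∷ʳ x) q) →
                       Inverted w₀ (σ w₀ p) (σ w₀ (τ n x q))
  inverted-∷ʳ-avoids w₀ {x} {p} {q} av inv =
    subst₂ (Inverted w₀) (σ-∷ʳ-avoids w₀ av) (σ-∷ʳ w₀ x q) (inverted-∷ʳ⁻ (¬crosses-avoids w₀ av) inv)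

  disk-∷ʳ-avoids : ∀ w₀ {x p q} → Avoids x p → Avoids x q →
                   Disk (w₀ ∷ʳ x) (σ (w₀ ∷ʳ x) p) (σ (w₀ ∷ʳ x) q) → Disk w₀ (σ w₀ p) (σ w₀ q)
  disk-∷ʳ-avoids w₀ {x} {p} {q} avp avq d =
    subst₂ (Disk w₀) (σ-∷ʳ-avoids w₀ avp) (σ-∷ʳ-avoids w₀ avq) (descend d)
    where
    descend : Disk (w₀ ∷ʳ x) (σ (w₀ ∷ʳ x) p) (σ (w₀ ∷ʳ x) q) → Disk w₀ (σ (w₀ ∷ʳ x) p) (σ (w₀ ∷ʳ x) q)
    descend (inj₁ ipq)             = inj₁ (inverted-∷ʳ⁻ (¬crosses-avoids w₀ avp) ipq)
    descend (inj₂ (c , ipc , iqc)) =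
      inj₂ (c , inverted-∷ʳ⁻ (¬crosses-avoids w₀ avp) ipc , inverted-∷ʳ⁻ (¬crosses-avoids w₀ avq) iqc)

  top-crossing-inverted : ∀ w₀ x {p q} → NoBigon (w₀ ∷ʳ x) → q ≡ p ⁺ → res p ≡ toℕ x →
                          Inverted (w₀ ∷ʳ x) (σ (w₀ ∷ʳ x) p) (σ (w₀ ∷ʳ x) q)
  top-crossing-inverted w₀ x {p} nb refl r≡x =
    crossed⇒inverted {v = []} nb (crosses⁻ (trans πa≡p⁺ (cong _⁺ (sym πb≡p))) (trans (cong res πb≡p) r≡x))
    where
    πa≡p⁺ : π w₀ (σ (w₀ ∷ʳ x) p) ≡ p ⁺
    πa≡p⁺ = trans (π-σ-∷ʳ w₀ x p) (proj₁ (τ-swaps x p r≡x))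
    πb≡p : π w₀ (σ (w₀ ∷ʳ x) (p ⁺)) ≡ p
    πb≡p = trans (π-σ-∷ʳ w₀ x (p ⁺)) (proj₂ (τ-swaps x p r≡x))

  module _ (w₀ : Word n) (x : Fin n) {k : Fin n} (P : ℤ) (ρ : res P ≡ toℕ k) where

    private
      w : Word n
      w = w₀ ∷ʳ x

      res-P⁺ : res (P ⁺) ≡ next (toℕ k)
      res-P⁺ = trans (res-⁺ P) (cong next ρ)

    top-crossing-above : NoBigon w → Next n k x → Inverted w (σ w (P ⁺)) (σ w (P ⁺ ⁺))
    top-crossing-above nb k⁺≡x = top-crossing-inverted w₀ x nb refl (trans res-P⁺ k⁺≡x)

    res-P⁻ : Next n x k → res (P ⁻) ≡ toℕ x
    res-P⁻ x⁺≡k = next-injective (res<n (P ⁻)) (Finₚ.toℕ<n x) (trans (next-res-⁻ P) (trans ρ (sym x⁺≡k)))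

    top-crossing-below : NoBigon w → Next n x k → Inverted w (σ w (P ⁻)) (σ w P)
    top-crossing-below nb x⁺≡k = top-crossing-inverted w₀ x nb (sym (⁻⁺ P)) (res-P⁻ x⁺≡k)

    inverted-∷ʳ-above : 3 ≤ n → Next n k x → Inverted w (σ w P) (σ w (P ⁺ ⁺)) →
                        Inverted w₀ (σ w₀ P) (σ w₀ (P ⁺))
    inverted-∷ʳ-above 3≤n k⁺≡x inv =
      subst (Inverted w₀ (σ w₀ P) ∘ σ w₀) (proj₂ (τ-swaps x (P ⁺) (trans res-P⁺ k⁺≡x)))
            (inverted-∷ʳ-avoids w₀ avoids inv)
      where
      avoids : Avoids x P
      avoids = (λ r≡x → next-toℕ-≢ k (trans k⁺≡x (trans (sym r≡x) ρ))) ,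
               (λ r≡x⁺ → next²-≢ 3≤n (Finₚ.toℕ<n k) (trans (cong next k⁺≡x) (trans (sym r≡x⁺) ρ)))

    inverted-∷ʳ-below : 3 ≤ n → Next n x k → Inverted w (σ w (P ⁻)) (σ w (P ⁺)) →
                        Inverted w₀ (σ w₀ P) (σ w₀ (P ⁺))
    inverted-∷ʳ-below 3≤n x⁺≡k inv =
      inverted-sym (subst (Inverted w₀ (σ w₀ (P ⁺)) ∘ σ w₀) τP⁻≡P
                          (inverted-∷ʳ-avoids w₀ avoids (inverted-sym inv)))
      where
      τP⁻≡P : τ n x (P ⁻) ≡ P
      τP⁻≡P = trans (τ-⁺ x (P ⁻) (res-P⁻ x⁺≡k)) (⁻⁺ P)
      avoids : Avoids x (P ⁺)
      avoids = (λ r≡x → next²-≢ 3≤n (Finₚ.toℕ<n x) (trans (cong next x⁺≡k) (trans (sym res-P⁺) r≡x))) ,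
               (λ r≡x⁺ → next-toℕ-≢ k (trans (sym res-P⁺) (trans r≡x⁺ x⁺≡k)))

    farApart⇒avoids : FarApart n k x → Avoids x P × Avoids x (P ⁺)
    farApart⇒avoids (k≢x , k⁺≢x , x⁺≢k) =
      (k≢x ∘ trans (sym ρ) , x⁺≢k ∘ sym ∘ trans (sym ρ)) ,
      (k⁺≢x ∘ trans (sym res-P⁺) , k≢x ∘ next-injective (Finₚ.toℕ<n k) (Finₚ.toℕ<n x) ∘ trans (sym res-P⁺))

    inverted-∷ʳ-far : FarApart n k x → Inverted w (σ w P) (σ w (P ⁺)) → Inverted w₀ (σ w₀ P) (σ w₀ (P ⁺))
    inverted-∷ʳ-far apart inv =
      subst (Inverted w₀ (σ w₀ P) ∘ σ w₀) (τ-avoids x (P ⁺) (proj₂ (farApart⇒avoids apart)))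
            (inverted-∷ʳ-avoids w₀ (proj₁ (farApart⇒avoids apart)) inv)

    closesDisk-∷ʳ-far : FarApart n k x → ClosesDisk w P → ClosesDisk w₀ P
    closesDisk-∷ʳ-far apart =
      disk-∷ʳ-avoids w₀ (proj₁ (farApart⇒avoids apart)) (proj₂ (farApart⇒avoids apart))

  ≈-++ʳ : ∀ {w w′} z → Equiv n w w′ → Equiv n (w ++ z) (w′ ++ z)
  ≈-++ʳ z ≈-refl         = ≈-refl
  ≈-++ʳ z (≈-sym e)      = ≈-sym (≈-++ʳ z e)
  ≈-++ʳ z (≈-trans e e′) = ≈-trans (≈-++ʳ z e) (≈-++ʳ z e′)
  ≈-++ʳ z (≈-move u {l} {r} v mv) = subst₂ (Equiv n) (regroup l) (regroup r) (≈-move u (v ++ z) mv)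
    where
    regroup : ∀ t → u ++ t ++ v ++ z ≡ (u ++ t ++ v) ++ z
    regroup t = sym (trans (Listₚ.++-assoc u (t ++ v) z) (cong (u ++_) (Listₚ.++-assoc t v z)))

  ≈-move-end : ∀ w {l r} → Move n l r → Equiv n (w ++ l) (w ++ r)
  ≈-move-end w {l} {r} mv =
    subst₂ (Equiv n) (cong (w ++_) (Listₚ.++-identityʳ l)) (cong (w ++_) (Listₚ.++-identityʳ r))
                     (≈-move w [] mv)

  ≈-setoid : Setoid _ _
  ≈-setoid = record
    { Carrier       = Word n
    ; _≈_           = Equiv n
    ; isEquivalence = record { refl = ≈-refl ; sym = ≈-sym ; trans = ≈-trans }
    }

  ∷ʳ-commute : ∀ w {k x} → FarApart n k x → Equiv n (w ∷ʳ k ∷ʳ x) (w ∷ʳ x ∷ʳ k)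
  ∷ʳ-commute w {k} {x} apart = begin
    w ∷ʳ k ∷ʳ x      ≡⟨ Listₚ.++-assoc w [ k ] [ x ] ⟩
    w ++ k ∷ x ∷ []  ≈⟨ ≈-move-end w (isotopy apart) ⟩
    w ++ x ∷ k ∷ []  ≡⟨ Listₚ.++-assoc w [ x ] [ k ] ⟨
    w ∷ʳ x ∷ʳ k      ∎
    where open SetoidReasoning ≈-setoid

  ∷ʳ-idempotent : ∀ w x → Equiv n (w ∷ʳ x ∷ʳ x) (w ∷ʳ x)
  ∷ʳ-idempotent w x = begin
    w ∷ʳ x ∷ʳ x      ≡⟨ Listₚ.++-assoc w [ x ] [ x ] ⟩
    w ++ x ∷ x ∷ []  ≈⟨ ≈-move-end w move2 ⟩
    w ∷ʳ x           ∎
    where open SetoidReasoning ≈-setoid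

  length-∷ʳ : ∀ (w : Word n) x → length (w ∷ʳ x) ≡ suc (length w)
  length-∷ʳ w x = trans (Listₚ.length-++ w) (ℕₚ.+-comm (length w) 1)

  length-<-∷ʳ : ∀ (w : Word n) x → length w ℕ.< length (w ∷ʳ x)
  length-<-∷ʳ w x = ℕₚ.≤-reflexive (sym (length-∷ʳ w x))

  length-∷ʳ-mono : ∀ (v w : Word n) x → length v ≤ length w → length (v ∷ʳ x) ≤ length (w ∷ʳ x)
  length-∷ʳ-mono v w x |v|≤|w| = subst₂ _≤_ (sym (length-∷ʳ v x)) (sym (length-∷ʳ w x)) (s≤s |v|≤|w|)

  EndsIn : Word n → Fin n → Set
  EndsIn w k = ∃[ w₁ ] (Equiv n w (w₁ ∷ʳ k) × length w₁ ℕ.< length w)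

  Reducible : Word n → Fin n → Set
  Reducible w k = ∃[ v ] (Equiv n (w ∷ʳ k) v × length v ≤ length w)

  endsIn-∷ʳ : ∀ {w₀ k} x → FarApart n k x → EndsIn w₀ k → EndsIn (w₀ ∷ʳ x) k
  endsIn-∷ʳ {w₀} x apart (w₁ , w₀≈ , |w₁|<|w₀|) =
    w₁ ∷ʳ x ,
    ≈-trans (≈-++ʳ [ x ] w₀≈) (∷ʳ-commute w₁ apart) ,
    subst₂ ℕ._<_ (sym (length-∷ʳ w₁ x)) (sym (length-∷ʳ w₀ x)) (s≤s |w₁|<|w₀|)

  reducible-∷ʳ : ∀ {w₀ k} x → FarApart n k x → Reducible w₀ k → Reducible (w₀ ∷ʳ x) k
  reducible-∷ʳ {w₀} x apart (v , w₀k≈v , |v|≤|w₀|) =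
    v ∷ʳ x ,
    ≈-trans (≈-sym (∷ʳ-commute w₀ apart)) (≈-++ʳ [ x ] w₀k≈v) ,
    length-∷ʳ-mono v w₀ x |v|≤|w₀|

  reducible-by-3-move : ∀ {w₀ x k y z} → EndsIn w₀ k → Move n (k ∷ x ∷ k ∷ []) (y ∷ z ∷ []) →
                        Reducible (w₀ ∷ʳ x) k
  reducible-by-3-move {w₀} {x} {k} {y} {z} (w₁ , w₀≈ , |w₁|<|w₀|) mv =
    w₁ ++ y ∷ z ∷ [] , equiv , subst₂ _≤_ (sym length-v) (sym (length-∷ʳ w₀ x)) (s≤s |w₁|<|w₀|)
    where
    equiv : Equiv n (w₀ ∷ʳ x ∷ʳ k) (w₁ ++ y ∷ z ∷ [])
    equiv = begin
      w₀ ∷ʳ x ∷ʳ k             ≡⟨ Listₚ.++-assoc w₀ [ x ] [ k ] ⟩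
      w₀ ++ x ∷ k ∷ []         ≈⟨ ≈-++ʳ (x ∷ k ∷ []) w₀≈ ⟩
      (w₁ ∷ʳ k) ++ x ∷ k ∷ []  ≡⟨ Listₚ.++-assoc w₁ [ k ] (x ∷ k ∷ []) ⟩
      w₁ ++ k ∷ x ∷ k ∷ []     ≈⟨ ≈-move-end w₁ mv ⟩
      w₁ ++ y ∷ z ∷ []         ∎
      where open SetoidReasoning ≈-setoid
    length-v : length (w₁ ++ y ∷ z ∷ []) ≡ suc (suc (length w₁))
    length-v = trans (Listₚ.length-++ w₁) (ℕₚ.+-comm (length w₁) 2)

  exchange : ∀ {w} → Reverse w → IsWeb n w → ∀ {k} P → res P ≡ toℕ k →
             Inverted w (σ w P) (σ w (P ⁺)) → EndsIn w k
  exchange [] _ _ _ inv = ⊥-elim (¬inverted-[] inv)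
  exchange (w₀ ∶ r ∶ʳ x) web@(nb , nt) {k} P ρ inv with adjacency k x
  ... | equal      = w₀ , ≈-refl , length-<-∷ʳ w₀ x
  ... | above k⁺≡x = ⊥-elim (nt (inversions⇒triangle _ inv i₁₂ (disk-left P nt i₁₂ (inj₁ inv))))
    where
    i₁₂ : Inverted (w₀ ∷ʳ x) (σ (w₀ ∷ʳ x) (P ⁺)) (σ (w₀ ∷ʳ x) (P ⁺ ⁺))
    i₁₂ = top-crossing-above w₀ x P ρ nb k⁺≡x
  ... | below x⁺≡k = ⊥-elim (nt (inversions⇒triangle _ i₋₀ inv (disk-right P nt i₋₀ (inj₁ inv))))
    where
    i₋₀ : Inverted (w₀ ∷ʳ x) (σ (w₀ ∷ʳ x) (P ⁻)) (σ (w₀ ∷ʳ x) P)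
    i₋₀ = top-crossing-below w₀ x P ρ nb x⁺≡k
  ... | far apart  = endsIn-∷ʳ x apart (exchange r (web-∷ʳ⁻ web) P ρ (inverted-∷ʳ-far w₀ x P ρ apart inv))

  module _ {w₀ : Word n} (r : Reverse w₀) (x : Fin n) (web : IsWeb n (w₀ ∷ʳ x))
           {k : Fin n} (P : ℤ) (ρ : res P ≡ toℕ k) where

    private
      w : Word n
      w = w₀ ∷ʳ x

    reduce-above : Next n k x → ¬ ClosesDisk w P ⊎ Reducible w k
    reduce-above k⁺≡x with inverted? w (σ w P) (σ w (P ⁺ ⁺))
    ... | no ¬inv = inj₁ (¬inv ∘ disk-left P (proj₂ web) (top-crossing-above w₀ x P ρ (proj₁ web) k⁺≡x))
    ... | yes inv = inj₂ (reducible-by-3-move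
                            (exchange r (web-∷ʳ⁻ web) P ρ (inverted-∷ʳ-above w₀ x P ρ 3≤n k⁺≡x inv))
                            (move3a 3≤n k⁺≡x))
      where
      3≤n : 3 ≤ n
      3≤n = inverted-at-distance-2⇒3≤n w refl inv

    reduce-below : Next n x k → ¬ ClosesDisk w P ⊎ Reducible w k
    reduce-below x⁺≡k with inverted? w (σ w (P ⁻)) (σ w (P ⁺))
    ... | no ¬inv = inj₁ (¬inv ∘ disk-right P (proj₂ web) (top-crossing-below w₀ x P ρ (proj₁ web) x⁺≡k))
    ... | yes inv = inj₂ (reducible-by-3-move
                            (exchange r (web-∷ʳ⁻ web) P ρ (inverted-∷ʳ-below w₀ x P ρ 3≤n x⁺≡k inv))
                            (move3b 3≤n x⁺≡k))
      where
      3≤n : 3 ≤ n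
      3≤n = inverted-at-distance-2⇒3≤n w (cong _⁺ (sym (⁻⁺ P))) inv

  reduce : ∀ {w} → Reverse w → IsWeb n w → ∀ {k} P → res P ≡ toℕ k → ¬ ClosesDisk w P ⊎ Reducible w k
  reduce [] _ _ _ = inj₁ ¬disk-[]
  reduce (w₀ ∶ r ∶ʳ x) web {k} P ρ with adjacency k x
  ... | equal      = inj₂ (w₀ ∷ʳ x , ∷ʳ-idempotent w₀ x , ℕₚ.≤-refl)
  ... | above k⁺≡x = reduce-above r x web P ρ k⁺≡x
  ... | below x⁺≡k = reduce-below r x web P ρ x⁺≡k
  ... | far apart  = Sum.map (_∘ closesDisk-∷ʳ-far w₀ x P ρ apart) (reducible-∷ʳ x apart)
                             (reduce r (web-∷ʳ⁻ web) P ρ)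

  WebForm : Word n → Set
  WebForm w = ∃[ v ] (IsWeb n v × Equiv n w v × length v ≤ length w)

  webForm-≈ : ∀ {w v} → Equiv n w v → length v ≤ length w → WebForm v → WebForm w
  webForm-≈ w≈v |v|≤|w| (v′ , web , v≈v′ , |v′|≤|v|) =
    v′ , web , ≈-trans w≈v v≈v′ , ℕₚ.≤-trans |v′|≤|v| |v|≤|w|

  webForm : ∀ w → Acc ℕ._<_ (length w) → WebForm w
  webForm w = go (reverseView w)
    where
    go : ∀ {w} → Reverse w → Acc ℕ._<_ (length w) → WebForm w
    go [] _ = [] , web-[] , ≈-refl , z≤n
    go (w₀ ∶ r ∶ʳ k) (acc rs) with go r (rs (length-<-∷ʳ w₀ k))
    ... | v₀ , web₀ , w₀≈v₀ , |v₀|≤|w₀| with reduce (reverseView v₀) web₀ (+ toℕ k) (res-+ (Finₚ.toℕ<n k))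
    ...   | inj₁ ¬closes =
      v₀ ∷ʳ k , web-∷ʳ web₀ ¬closes , ≈-++ʳ [ k ] w₀≈v₀ , length-∷ʳ-mono v₀ w₀ k |v₀|≤|w₀|
    ...   | inj₂ (v , v₀k≈v , |v|≤|v₀|) =
      webForm-≈ (≈-trans (≈-++ʳ [ k ] w₀≈v₀) v₀k≈v) (ℕₚ.<⇒≤ |v|<|w₀k|) (webForm v (rs |v|<|w₀k|))
      where
      |v|<|w₀k| : length v ℕ.< length (w₀ ∷ʳ k)
      |v|<|w₀k| = ℕₚ.≤-<-trans (ℕₚ.≤-trans |v|≤|v₀| |v₀|≤|w₀|) (length-<-∷ʳ w₀ k)

  equivalent-web : ∀ w → ∃[ w′ ] (IsWeb n w′ × Equiv n w w′)
  equivalent-web w with webForm w (<-wellFounded (length w))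
  ... | w′ , web , w≈w′ , _ = w′ , web , w≈w′

proposition4p3 : (n : ℕ) → 2 ≤ n → (w : Word n) →
    ∃[ w′ ] (IsWeb n w′ × Equiv n w w′)
proposition4p3 (suc (suc m)) _ w = Cylinder.equivalent-web m w
proposition4p3 (suc zero) (s≤s ()) w
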